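{- Let $m\ge0$ and let $A=\{a_0,\dots,a_m\}$, $B=\{b_0,\dots,b_m\}$ be two multisets of integers (indexed as shown). Assume $a_0\ge b_0$ and that for every $i>0$, either $b_i>a_0$ or $b_i\le b_0$. Then $$\max_{\tau\in S_m^*}\#\{i\in I_m^*: a_i\ge b_{\tau(i)}\}=1+\max_{\sigma\in S_m}\#\{i\in I_m: a_i\ge b_{\sigma(i)}\}.$$
   Context: $I_m=\{1,\dots,m\}$, $I_m^*=\{0,1,\dots,m\}$; $S_m$ and $S_m^*$ denote the sets of permutations of $I_m$ and $I_m^*$ respectively. -}

module Defs where

open import Data.Nat using (ℕ; zero; suc; _≤_)
open import Data.Fin using (Fin; zero; suc)
open import Data.Fin.Permutation using (Permutation′; _⟨$⟩ʳ_)
open import Data.Integer using (ℤ) renaming (_≤_ to _≤ℤ_)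
open import Data.Integer.Properties using (_≤?_)
open import Data.Product using (Σ; _×_)
open import Relation.Binary.PropositionalEquality using (_≡_)
open import Relation.Nullary using (Dec; yes; no)

countFin : (n : ℕ) → (P : Fin n → Set) → ((i : Fin n) → Dec (P i)) → ℕ
countFin zero P d = 0
countFin (suc n) P d with d zero
... | yes _ = suc (countFin n (λ i → P (suc i)) (λ i → d (suc i)))
... | no _ = countFin n (λ i → P (suc i)) (λ i → d (suc i))


matches* : (m : ℕ) → (a b : Fin (suc m) → ℤ) → Permutation′ (suc m) → ℕ
matches* m a b τ = countFin (suc m) (λ i → b (τ ⟨$⟩ʳ i) ≤ℤ a i) (λ i → b (τ ⟨$⟩ʳ i) ≤? a i)

-- #{ i ∈ I_m : a_i ≥ b_{σ(i)} }, with I_m = {1..m} encoded as suc : Fin m → Fin (suc m)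
matches : (m : ℕ) → (a b : Fin (suc m) → ℤ) → Permutation′ m → ℕ
matches m a b σ = countFin m (λ i → b (suc (σ ⟨$⟩ʳ i)) ≤ℤ a (suc i))
                             (λ i → b (suc (σ ⟨$⟩ʳ i)) ≤? a (suc i))

IsMaxOver : (X : Set) → (X → ℕ) → ℕ → Set
IsMaxOver X f M = Σ X (λ x → f x ≡ M) × ((x : X) → f x ≤ M)

{-# OPTIONS --safe #-}
-- A best assignment τ may be assumed to fix 0: let k = τ⁻¹(0) and swap the
-- targets of 0 and k. Position 0 now scores (as a₀ ≥ b₀), and position k trades
-- the test a_k ≥ b₀ for a_k ≥ b_{τ(0)} (if k ≠ 0). If a₀ ≥ b_{τ(0)} then τ(0) ≠ 0 forces
-- b_{τ(0)} ≤ b₀, so position k can only gain; otherwise position 0 gained a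
-- point, which pays for anything lost at k. Hence the optimum over S*_m is
-- attained by permutations fixing 0, i.e. by lifts of permutations in S_m.
module Submission where

open import Defs
import Algebra.Properties.CommutativeMonoid.Sum
open import Data.Nat using (ℕ; suc; zero; _+_; z≤n; s≤s) renaming (_≤_ to _≤ℕ_)
open import Data.Nat.Properties
  using (+-0-commutativeMonoid; ≤-antisym; ≤-refl; ≤-trans; m≤m+n; +-mono-≤; +-assoc; ≤-reflexive; module ≤-Reasoning)
open import Data.Fin using (Fin; zero; suc; _≟_; punchIn)
open import Data.Fin.Properties using (punchInᵢ≢i; suc-injective)
open import Data.Fin.Permutation
  using (Permutation′; _⟨$⟩ʳ_; _⟨$⟩ˡ_; _≈_; lift₀; remove; lift₀-remove; transpose; _∘ₚ_; inverseʳ)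
import Data.Fin.Permutation.Components as PC
open import Data.Integer using (ℤ; _≤_; _<_)
open import Data.Integer.Properties using (_≤?_; <⇒≱) renaming (≤-refl to ≤ℤ-refl; ≤-trans to ≤ℤ-trans)
open import Data.Vec.Functional using (Vector; tail; removeAt)
open import Data.Sum using (_⊎_; inj₁; inj₂)
open import Data.Product using (Σ; _×_; _,_)
open import Relation.Nullary using (Dec; yes; no; contradiction)
open import Relation.Nullary.Decidable using (dec-true; dec-false)
open import Relation.Binary.PropositionalEquality using (_≡_; _≢_; refl; sym; trans; cong; cong₂; subst; subst₂; module ≡-Reasoning)

open Algebra.Properties.CommutativeMonoid.Sum +-0-commutativeMonoid
  using (sum; sum-remove; sum-cong-≗)

indicator : {P : Set} → Dec P → ℕ
indicator (yes _) = 1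
indicator (no _)  = 0

indicator≤1 : {P : Set} (p? : Dec P) → indicator p? ≤ℕ 1
indicator≤1 (yes _) = s≤s z≤n
indicator≤1 (no _)  = z≤n

indicator-yes : {P : Set} → P → (p? : Dec P) → indicator p? ≡ 1
indicator-yes p (yes _) = refl
indicator-yes p (no ¬p) = contradiction p ¬p

indicator-mono : {P Q : Set} → (P → Q) → (p? : Dec P) (q? : Dec Q) → indicator p? ≤ℕ indicator q?
indicator-mono P⇒Q (yes _) (yes _) = ≤-refl
indicator-mono P⇒Q (yes p) (no ¬q) = contradiction (P⇒Q p) ¬q
indicator-mono P⇒Q (no _)  q?      = z≤n

countFin≡sum-indicator : (n : ℕ) {P : Fin n → Set} (P? : (i : Fin n) → Dec (P i)) →
  countFin n P P? ≡ sum (λ i → indicator (P? i))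
countFin≡sum-indicator zero    P? = refl
countFin≡sum-indicator (suc n) P? with P? zero
... | yes _ = cong suc (countFin≡sum-indicator n (λ i → P? (suc i)))
... | no _  = countFin≡sum-indicator n (λ i → P? (suc i))

sum-≤-except : ∀ {n} (f g : Vector ℕ n) (p : Fin n) {c : ℕ} →
  (∀ i → i ≢ p → f i ≡ g i) → f p ≤ℕ c + g p → sum f ≤ℕ c + sum g
sum-≤-except {suc n} f g p {c} f≡g fp≤ = begin
  sum f                                 ≡⟨ sum-remove f ⟩
  f p + sum (removeAt f p)              ≤⟨ +-mono-≤ fp≤ (≤-reflexive rest≡) ⟩
  c + g p + sum (removeAt g p)          ≡⟨ +-assoc c (g p) _ ⟩
  c + (g p + sum (removeAt g p))        ≡⟨ cong (c +_) (sym (sum-remove g)) ⟩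
  c + sum g                             ∎
  where
  open ≤-Reasoning
  rest≡ : sum (removeAt f p) ≡ sum (removeAt g p)
  rest≡ = sum-cong-≗ (λ i → f≡g (punchIn p i) (punchInᵢ≢i p i))

transpose-matchʳ : ∀ {n} (i j : Fin n) → PC.transpose i j j ≡ i
transpose-matchʳ i j with j ≟ i
... | yes j≡i = j≡i
... | no _ rewrite dec-true (j ≟ j) refl = refl

transpose-mismatch : ∀ {n} {i j k : Fin n} → k ≢ i → k ≢ j → PC.transpose i j k ≡ k
transpose-mismatch {i = i} {j} {k} k≢i k≢j
  rewrite dec-false (k ≟ i) k≢i | dec-false (k ≟ j) k≢j = refl

module _ (m : ℕ) (a b : Fin (suc m) → ℤ) where

  hits : Permutation′ (suc m) → Vector ℕ (suc m)
  hits π i = indicator (b (π ⟨$⟩ʳ i) ≤? a i)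

  matches*≡sum-hits : (π : Permutation′ (suc m)) → matches* m a b π ≡ sum (hits π)
  matches*≡sum-hits π = countFin≡sum-indicator (suc m) (λ i → b (π ⟨$⟩ʳ i) ≤? a i)

  matches*-cong : {π π′ : Permutation′ (suc m)} → π ≈ π′ → matches* m a b π ≡ matches* m a b π′
  matches*-cong {π} {π′} π≈π′ = begin
    matches* m a b π   ≡⟨ matches*≡sum-hits π ⟩
    sum (hits π)       ≡⟨ sum-cong-≗ (λ i → cong (λ x → indicator (b x ≤? a i)) (π≈π′ i)) ⟩
    sum (hits π′)      ≡⟨ matches*≡sum-hits π′ ⟨
    matches* m a b π′  ∎
    where open ≡-Reasoning

  bⱼ≤a₀⇒bⱼ≤b₀ : ((i : Fin m) → (a zero < b (suc i)) ⊎ (b (suc i) ≤ b zero)) →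
    (j : Fin (suc m)) → b j ≤ a zero → b j ≤ b zero
  bⱼ≤a₀⇒bⱼ≤b₀ H zero    _     = ≤ℤ-refl
  bⱼ≤a₀⇒bⱼ≤b₀ H (suc i) bⱼ≤a₀ with H i
  ... | inj₁ a₀<bⱼ = contradiction bⱼ≤a₀ (<⇒≱ a₀<bⱼ)
  ... | inj₂ bⱼ≤b₀ = bⱼ≤b₀

  module _ (b₀≤a₀ : b zero ≤ a zero) where

    matches*-lift₀ : (σ : Permutation′ m) → matches* m a b (lift₀ σ) ≡ suc (matches m a b σ)
    matches*-lift₀ σ = trans (matches*≡sum-hits (lift₀ σ)) (cong₂ _+_ hit-at-zero (sym tail≡matches))
      where
      hit-at-zero : hits (lift₀ σ) zero ≡ 1
      hit-at-zero = indicator-yes b₀≤a₀ (b zero ≤? a zero)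
      tail≡matches : matches m a b σ ≡ sum (tail (hits (lift₀ σ)))
      tail≡matches = countFin≡sum-indicator m (λ i → b (suc (σ ⟨$⟩ʳ i)) ≤? a (suc i))

    matches*-fixing-zero : (π : Permutation′ (suc m)) → π ⟨$⟩ʳ zero ≡ zero →
      matches* m a b π ≡ suc (matches m a b (remove zero π))
    matches*-fixing-zero π π₀≡0 = trans
      (sym (matches*-cong {lift₀ (remove zero π)} {π} (lift₀-remove π π₀≡0)))
      (matches*-lift₀ (remove zero π))

    exchange-to-zero : (∀ j → b j ≤ a zero → b j ≤ b zero) →
      (τ : Permutation′ (suc m)) →
      Σ (Permutation′ (suc m)) λ ρ → ρ ⟨$⟩ʳ zero ≡ zero × matches* m a b τ ≤ℕ matches* m a b ρ
    exchange-to-zero ≤a₀⇒≤b₀ τ = swap-with (τ ⟨$⟩ˡ zero) (inverseʳ τ)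
      where
      swap-with : (k : Fin (suc m)) → τ ⟨$⟩ʳ k ≡ zero →
        Σ (Permutation′ (suc m)) λ ρ → ρ ⟨$⟩ʳ zero ≡ zero × matches* m a b τ ≤ℕ matches* m a b ρ
      swap-with zero    τ₀≡0 = τ , τ₀≡0 , ≤-refl
      -- ρ(0) reduces to τ(k), so τₖ≡0 already says that ρ fixes 0.
      swap-with (suc k) τₖ≡0 =
        ρ , τₖ≡0 , subst₂ _≤ℕ_ (sym (matches*≡sum-hits τ)) (sym (matches*≡sum-hits ρ)) gain
        where
        ρ : Permutation′ (suc m)
        ρ = transpose zero (suc k) ∘ₚ τ

        j : Fin (suc m)
        j = τ ⟨$⟩ʳ zero

        ρₖ≡j : ρ ⟨$⟩ʳ suc k ≡ j
        ρₖ≡j = cong (τ ⟨$⟩ʳ_) (transpose-matchʳ zero (suc k))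

        agree : ∀ i → i ≢ k → tail (hits τ) i ≡ tail (hits ρ) i
        agree i i≢k = cong (λ x → indicator (b (τ ⟨$⟩ʳ x) ≤? a (suc i)))
          (sym (transpose-mismatch {i = zero} (λ ()) (λ eq → i≢k (suc-injective eq))))

        ρ-hits-zero : hits ρ zero ≡ 1
        ρ-hits-zero = indicator-yes (subst (λ x → b x ≤ a zero) (sym τₖ≡0) b₀≤a₀) _

        hits-at-k : b j ≤ a zero → tail (hits τ) k ≤ℕ 0 + tail (hits ρ) k
        hits-at-k bⱼ≤a₀ = indicator-mono bₖ≤aₖ⇒ _ _
          where
          bₖ≤aₖ⇒ : b (τ ⟨$⟩ʳ suc k) ≤ a (suc k) → b (ρ ⟨$⟩ʳ suc k) ≤ a (suc k)
          bₖ≤aₖ⇒ le = subst (λ x → b x ≤ a (suc k)) (sym ρₖ≡j)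
            (≤ℤ-trans (≤a₀⇒≤b₀ j bⱼ≤a₀) (subst (λ x → b x ≤ a (suc k)) τₖ≡0 le))

        head-and-tail : indicator (b j ≤? a zero) + sum (tail (hits τ)) ≤ℕ 1 + sum (tail (hits ρ))
        head-and-tail with b j ≤? a zero
        ... | yes bⱼ≤a₀ = s≤s (sum-≤-except (tail (hits τ)) (tail (hits ρ)) k agree (hits-at-k bⱼ≤a₀))
        ... | no _      = sum-≤-except (tail (hits τ)) (tail (hits ρ)) k agree
                            (≤-trans (indicator≤1 _) (m≤m+n 1 _))

        gain : sum (hits τ) ≤ℕ sum (hits ρ)
        gain = begin
          hits τ zero + sum (tail (hits τ))  ≤⟨ head-and-tail ⟩
          1 + sum (tail (hits ρ))            ≡⟨ cong (_+ sum (tail (hits ρ))) ρ-hits-zero ⟨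
          hits ρ zero + sum (tail (hits ρ))  ∎
          where open ≤-Reasoning

lemma2p2 : (m : ℕ) → (a b : Fin (suc m) → ℤ) →
    b zero ≤ a zero →
    ((i : Fin m) → (a zero < b (suc i)) ⊎ (b (suc i) ≤ b zero)) →
    (M N : ℕ) →
    IsMaxOver (Permutation′ (suc m)) (matches* m a b) N →
    IsMaxOver (Permutation′ m) (matches m a b) M →
    N ≡ suc M
lemma2p2 m a b b₀≤a₀ H M N ((τ , τ-attains) , τ-max) ((σ , σ-attains) , σ-max) = ≤-antisym upper lower
  where
  open ≤-Reasoning

  lower : suc M ≤ℕ N
  lower = begin
    suc M                      ≡⟨ cong suc σ-attains ⟨
    suc (matches m a b σ)      ≡⟨ matches*-lift₀ m a b b₀≤a₀ σ ⟨
    matches* m a b (lift₀ σ)   ≤⟨ τ-max (lift₀ σ) ⟩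
    N                          ∎

  upper : N ≤ℕ suc M
  upper with exchange-to-zero m a b b₀≤a₀ (bⱼ≤a₀⇒bⱼ≤b₀ m a b H) τ
  ... | ρ , ρ₀≡0 , τ≤ρ = begin
    N                                      ≡⟨ τ-attains ⟨
    matches* m a b τ                       ≤⟨ τ≤ρ ⟩
    matches* m a b ρ                       ≡⟨ matches*-fixing-zero m a b b₀≤a₀ ρ ρ₀≡0 ⟩
    suc (matches m a b (remove zero ρ))    ≤⟨ s≤s (σ-max (remove zero ρ)) ⟩
    suc M                                  ∎
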